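{- Every (finite, simple) graph with no dominating $K_4$-model is $2$-degenerate and $3$-colourable.
   Context: A dominating $K_t$-model in a graph $G$ is a sequence $(T_1,\dots,T_t)$ of pairwise disjoint non-empty connected subgraphs of $G$ such that for all $1\le i<j\le t$, every vertex of $T_j$ has a neighbour in $T_i$. -}

module Defs where

open import Data.Nat using (ℕ; _≤_; _<_)
open import Data.Fin using (Fin; _<_)
open import Data.Fin.Subset using (Subset; _∈_; _∉_; _∩_; ∣_∣; Nonempty)
open import Data.Bool using (Bool; true; false; T)
open import Data.Vec using (tabulate)
open import Data.Product using (Σ; ∃; _×_; _,_)
open import Relation.Binary.PropositionalEquality using (_≡_; _≢_)
open import Relation.Nullary using (¬_)

record Graph (n : ℕ) : Set where
  field
    adj   : Fin n → Fin n → Bool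
    sym   : ∀ u v → adj u v ≡ adj v u
    irrefl : ∀ v → adj v v ≡ false

module _ {n : ℕ} (G : Graph n) where
  open Graph G

  Adj : Fin n → Fin n → Set
  Adj u v = T (adj u v)

  N : Fin n → Subset n
  N v = tabulate (adj v)

  data WalkIn (S : Subset n) : Fin n → Fin n → Set where
    here : ∀ {v} → v ∈ S → WalkIn S v v
    step : ∀ {u w v} → u ∈ S → Adj u w → WalkIn S w v → WalkIn S u v

  Connected : Subset n → Set
  Connected S = ∀ u v → u ∈ S → v ∈ S → WalkIn S u v

  Disjoint : Subset n → Subset n → Set
  Disjoint A B = ∀ v → v ∈ A → v ∉ B

  -- dominating K_t-model (T_1,...,T_t), branch sets given by their vertex sets
  -- (each T_i a connected subgraph; taking the induced subgraph is w.l.o.g.)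
  record DominatingModel (t : ℕ) : Set where
    field
      branch    : Fin t → Subset n
      nonempty  : ∀ i → Nonempty (branch i)
      connected : ∀ i → Connected (branch i)
      disjoint  : ∀ i j → i ≢ j → Disjoint (branch i) (branch j)
      dominating : ∀ i j → i Data.Fin.< j → ∀ v → v ∈ branch j →
                   ∃ λ u → u ∈ branch i × Adj v u

  degIn : Subset n → Fin n → ℕ
  degIn S v = ∣ S ∩ N v ∣

  Degenerate : ℕ → Set
  Degenerate d = ∀ (S : Subset n) → Nonempty S →
                 ∃ λ v → v ∈ S × degIn S v ≤ d

  Colourable : ℕ → Set
  Colourable k = ∃ λ (c : Fin n → Fin k) → ∀ u v → Adj u v → c u ≢ c v

{-# OPTIONS --safe #-}
-- A graph of minimum degree 2 has a dominating K₃-model: grow a path until its head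
-- has a neighbour earlier on it. So a dominating K₄-model arises from a connected set K
-- together with a subgraph of minimum degree 2 all of whose vertices have a neighbour in K.
--
-- Starting from a nonempty subgraph of minimum degree 3, we keep a connected K and a set X
-- disjoint from it in which every vertex has three neighbours in X, or has two and a
-- neighbour in K. If K dominates no vertex of X, restart inside X. Otherwise follow the
-- vertices of X-degree 2, which are dominated by K and form paths and cycles: this yields
-- a subgraph Z ⊆ X of minimum degree 2 that either is dominated by K, giving the model, or
-- misses a vertex y dominated by K. In the latter case K absorbs all of X − Z it can reach,
-- including y, and X shrinks. Hence a graph without a dominating K₄-model is 2-degenerate,
-- and greedily 3-colourable.
module Submission where

open import Defs
open import Data.Nat using (ℕ; zero; suc; _≤_; _<_; z≤n; s≤s; s≤s⁻¹; _≤?_)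
open import Data.Nat.Properties using (≤-refl; ≤-trans; ≰⇒>; ≤⇒≯; n≤1+n; n≮0)
open import Data.Fin using (Fin; zero; suc; _≟_)
open import Data.Fin.Properties using (any?; suc-injective; 0≢1+n)
open import Data.Fin.Subset
  using (Subset; _∈_; _∉_; _⊆_; _⊂_; _⊃_; _∩_; _∪_; _─_; _-_; ⁅_⁆; ∣_∣; ⊤; Nonempty; inside; outside)
open import Data.Fin.Subset.Properties
  using (_∈?_; nonempty?; Empty-unique; ∣⊥∣≡0; x∈⁅x⁆; x∈⁅y⁆⇒x≡y; x∉⁅y⁆⇒x≢y
        ; x∈p∩q⁺; x∈p∩q⁻; x∈p∪q⁻; p⊆p∪q; q⊆p∪q; x∈p∧x∉q⇒x∈p─q; p─q⊆p
        ; x∈p∧x≢y⇒x∈p-y; x∈p⇒p-x⊂p; x∈p⇒∣p-x∣<∣p∣; p⊆q⇒∣p∣≤∣q∣; ∪-identityʳ; ∈⊤)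
open import Data.Fin.Subset.Induction using (Acc; acc; ⊂-wellFounded; ⊃-wellFounded)
open import Data.Vec using (_∷_; here; there; tabulate)
open import Data.Vec.Properties using (lookup∘tabulate; []=⇒lookup; lookup⇒[]=)
open import Data.Bool using (Bool; T)
open import Data.Bool.Properties using (T?; T-≡)
open import Data.Product using (Σ; ∃; _×_; _,_; proj₁; proj₂; map₁; map₂)
open import Data.Sum using (_⊎_; inj₁; inj₂; [_,_]′) renaming (map₁ to ⊎-map₁; map₂ to ⊎-map₂)
open import Data.Empty using (⊥-elim)
open import Function using (id; _∘_; const; Equivalence)
open import Function.Definitions using (Injective)
open import Data.Vec.Functional using (updateAt)
open import Data.Vec.Functional.Properties using (updateAt-updates; updateAt-minimal)
open import Relation.Nullary using (¬_; Dec; yes; no)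
open import Relation.Nullary.Decidable using (_×-dec_; ¬?; ⌊_⌋; toWitness; fromWitness; decidable-stable)
open import Relation.Binary.PropositionalEquality using (_≡_; _≢_; refl; sym; trans; cong; subst)

x∈p─q⇒x∉q : ∀ {n x} {p q : Subset n} → x ∈ p ─ q → x ∉ q
x∈p─q⇒x∉q {p = _ ∷ _} {outside ∷ _} here        ()
x∈p─q⇒x∉q {p = _ ∷ _} {_ ∷ _} (there x∈p─q) (there x∈q) = x∈p─q⇒x∉q x∈p─q x∈q

∣p∪⁅x⁆∣≤1+∣p∣ : ∀ {n} (p : Subset n) x → ∣ p ∪ ⁅ x ⁆ ∣ ≤ suc ∣ p ∣
∣p∪⁅x⁆∣≤1+∣p∣ (inside  ∷ p) zero    rewrite ∪-identityʳ p = n≤1+n _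
∣p∪⁅x⁆∣≤1+∣p∣ (outside ∷ p) zero    rewrite ∪-identityʳ p = ≤-refl
∣p∪⁅x⁆∣≤1+∣p∣ (inside  ∷ p) (suc x) = s≤s (∣p∪⁅x⁆∣≤1+∣p∣ p x)
∣p∪⁅x⁆∣≤1+∣p∣ (outside ∷ p) (suc x) = ∣p∪⁅x⁆∣≤1+∣p∣ p x

module _ {n : ℕ} where

  p⊆p-x∪⁅x⁆ : ∀ (p : Subset n) x → p ⊆ (p - x) ∪ ⁅ x ⁆
  p⊆p-x∪⁅x⁆ p x {y} y∈p with y ≟ x
  ... | yes refl = q⊆p∪q (p - x) ⁅ x ⁆ (x∈⁅x⁆ x)
  ... | no  y≢x  = p⊆p∪q ⁅ x ⁆ (x∈p∧x≢y⇒x∈p-y y∈p y≢x)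

  ∣p∣≤1+∣p-x∣ : ∀ (p : Subset n) x → ∣ p ∣ ≤ suc ∣ p - x ∣
  ∣p∣≤1+∣p-x∣ p x = ≤-trans (p⊆q⇒∣p∣≤∣q∣ (p⊆p-x∪⁅x⁆ p x)) (∣p∪⁅x⁆∣≤1+∣p∣ (p - x) x)

  x∈p⇒0<∣p∣ : ∀ {x} {p : Subset n} → x ∈ p → 0 < ∣ p ∣
  x∈p⇒0<∣p∣ x∈p = ≤-trans (s≤s z≤n) (x∈p⇒∣p-x∣<∣p∣ x∈p)

  0<∣p∣⇒nonempty : ∀ {p : Subset n} → 0 < ∣ p ∣ → Nonempty p
  0<∣p∣⇒nonempty {p} 0<∣p∣ with nonempty? p
  ... | yes ne = ne
  ... | no ¬ne = ⊥-elim (n≮0 (subst (0 <_) (∣⊥∣≡0 n) (subst (λ q → 0 < ∣ q ∣) (Empty-unique ¬ne) 0<∣p∣)))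

  two-distinct⇒1<∣p∣ : ∀ {x y} {p : Subset n} → x ∈ p → y ∈ p → x ≢ y → 1 < ∣ p ∣
  two-distinct⇒1<∣p∣ x∈p y∈p x≢y = ≤-trans (s≤s (x∈p⇒0<∣p∣ (x∈p∧x≢y⇒x∈p-y y∈p (x≢y ∘ sym)))) (x∈p⇒∣p-x∣<∣p∣ x∈p)

  three-distinct⇒2<∣p∣ : ∀ {x y z} {p : Subset n} → x ∈ p → y ∈ p → z ∈ p → x ≢ y → x ≢ z → y ≢ z → 2 < ∣ p ∣
  three-distinct⇒2<∣p∣ x∈p y∈p z∈p x≢y x≢z y≢z =
    ≤-trans (s≤s (two-distinct⇒1<∣p∣ (x∈p∧x≢y⇒x∈p-y y∈p (x≢y ∘ sym)) (x∈p∧x≢y⇒x∈p-y z∈p (x≢z ∘ sym)) y≢z))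
            (x∈p⇒∣p-x∣<∣p∣ x∈p)

  x∈p-y⇒x≢y : ∀ {x y} {p : Subset n} → x ∈ p - y → x ≢ y
  x∈p-y⇒x≢y x∈p-y = x∉⁅y⁆⇒x≢y (x∈p─q⇒x∉q x∈p-y)

  1<∣p∣⇒∃≢ : ∀ {p : Subset n} → 1 < ∣ p ∣ → ∀ y → ∃ λ x → x ∈ p × x ≢ y
  1<∣p∣⇒∃≢ {p} 1<∣p∣ y with 0<∣p∣⇒nonempty (s≤s⁻¹ (≤-trans 1<∣p∣ (∣p∣≤1+∣p-x∣ p y)))
  ... | x , x∈p-y = x , p─q⊆p p ⁅ y ⁆ x∈p-y , x∈p-y⇒x≢y x∈p-y

  2<∣p∣⇒∃≢≢ : ∀ {p : Subset n} → 2 < ∣ p ∣ → ∀ y z → ∃ λ x → x ∈ p × x ≢ y × x ≢ z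
  2<∣p∣⇒∃≢≢ {p} 2<∣p∣ y z with 1<∣p∣⇒∃≢ (s≤s⁻¹ (≤-trans 2<∣p∣ (∣p∣≤1+∣p-x∣ p y))) z
  ... | x , x∈p-y , x≢z = x , p─q⊆p p ⁅ y ⁆ x∈p-y , x∈p-y⇒x≢y x∈p-y , x≢z

  ∣p∣≤2⇒∈-two : ∀ {x y z} {p : Subset n} → ∣ p ∣ ≤ 2 → x ∈ p → y ∈ p → x ≢ y → z ∈ p → z ≡ x ⊎ z ≡ y
  ∣p∣≤2⇒∈-two {x} {y} {z} ∣p∣≤2 x∈p y∈p x≢y z∈p with z ≟ x | z ≟ y
  ... | yes z≡x | _       = inj₁ z≡x
  ... | no  _   | yes z≡y = inj₂ z≡y
  ... | no  z≢x | no  z≢y = ⊥-elim (≤⇒≯ ∣p∣≤2 (three-distinct⇒2<∣p∣ x∈p y∈p z∈p x≢y (z≢x ∘ sym) (z≢y ∘ sym)))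

  ⁅x⁆⊆p : ∀ {x} {p : Subset n} → x ∈ p → ⁅ x ⁆ ⊆ p
  ⁅x⁆⊆p {x} x∈p y∈⁅x⁆ = subst (_∈ _) (sym (x∈⁅y⁆⇒x≡y x y∈⁅x⁆)) x∈p

  ∈⁅x⁆∪⁅y⁆⁻ : ∀ {x y z : Fin n} → z ∈ ⁅ x ⁆ ∪ ⁅ y ⁆ → z ≡ x ⊎ z ≡ y
  ∈⁅x⁆∪⁅y⁆⁻ {x} {y} z∈ = [ inj₁ ∘ x∈⁅y⁆⇒x≡y x , inj₂ ∘ x∈⁅y⁆⇒x≡y y ]′ (x∈p∪q⁻ ⁅ x ⁆ ⁅ y ⁆ z∈)

  p⊂p∪⁅x⁆ : ∀ {x} {p : Subset n} → x ∉ p → p ⊂ p ∪ ⁅ x ⁆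
  p⊂p∪⁅x⁆ {x} {p} x∉p = p⊆p∪q ⁅ x ⁆ , x , q⊆p∪q p ⁅ x ⁆ (x∈⁅x⁆ x) , x∉p

  x∈tabulate⁺ : ∀ {f : Fin n → Bool} {x} → T (f x) → x ∈ tabulate f
  x∈tabulate⁺ {f} {x} fx = lookup⇒[]= x (tabulate f) (trans (lookup∘tabulate f x) (Equivalence.to T-≡ fx))

  x∈tabulate⁻ : ∀ {f : Fin n → Bool} {x} → x ∈ tabulate f → T (f x)
  x∈tabulate⁻ {f} {x} x∈ = Equivalence.from T-≡ (trans (sym (lookup∘tabulate f x)) ([]=⇒lookup x∈))

  injective⇒≤∣p∣ : ∀ {m} {p : Subset n} (f : Fin m → Fin n) → Injective _≡_ _≡_ f → (∀ i → f i ∈ p) → m ≤ ∣ p ∣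
  injective⇒≤∣p∣ {zero}  f _ _ = z≤n
  injective⇒≤∣p∣ {suc m} f f-injective f∈p = ≤-trans
    (s≤s (injective⇒≤∣p∣ (f ∘ suc) (suc-injective ∘ f-injective)
      λ i → x∈p∧x≢y⇒x∈p-y (f∈p (suc i)) λ f1+i≡f0 → 0≢1+n (sym (f-injective f1+i≡f0))))
    (x∈p⇒∣p-x∣<∣p∣ (f∈p zero))

module _ {n : ℕ} (G : Graph n) where
  open Graph G using (adj) renaming (sym to adj-sym; irrefl to adj-irrefl)

  infix 4 _∼_
  _∼_ : Fin n → Fin n → Set
  u ∼ v = Adj G u v

  ∼-sym : ∀ {u v} → u ∼ v → v ∼ u
  ∼-sym {u} {v} = subst T (adj-sym u v)

  ∼-irrefl : ∀ {v} → ¬ v ∼ v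
  ∼-irrefl {v} = subst T (adj-irrefl v)

  ∼⇒≢ : ∀ {u v} → u ∼ v → u ≢ v
  ∼⇒≢ u∼u refl = ∼-irrefl u∼u

  _∼?_ : ∀ u v → Dec (u ∼ v)
  u ∼? v = T? (adj u v)

  ∈∩N⁺ : ∀ {X u v} → u ∈ X → v ∼ u → u ∈ X ∩ N G v
  ∈∩N⁺ u∈X v∼u = x∈p∩q⁺ (u∈X , x∈tabulate⁺ v∼u)

  ∈∩N⁻ : ∀ {X u v} → u ∈ X ∩ N G v → u ∈ X × v ∼ u
  ∈∩N⁻ {X} {u} {v} u∈X∩Nv with x∈p∩q⁻ X (N G v) u∈X∩Nv
  ... | u∈X , u∈Nv = u∈X , x∈tabulate⁻ u∈Nv

  DominatedBy : Subset n → Fin n → Set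
  DominatedBy K v = ∃ λ u → u ∈ K × v ∼ u

  dominatedBy? : ∀ K v → Dec (DominatedBy K v)
  dominatedBy? K v = any? (λ u → u ∈? K ×-dec v ∼? u)

  MinDegree : Subset n → ℕ → Set
  MinDegree Z d = ∀ {v} → v ∈ Z → d ≤ degIn G Z v

  degIn-mono : ∀ {X Y v} → (∀ {u} → u ∈ X → v ∼ u → u ∈ Y) → degIn G X v ≤ degIn G Y v
  degIn-mono X∩Nv⊆Y = p⊆q⇒∣p∣≤∣q∣ λ u∈X∩Nv →
    let u∈X , v∼u = ∈∩N⁻ u∈X∩Nv in ∈∩N⁺ (X∩Nv⊆Y u∈X v∼u) v∼u

  degIn-─ : ∀ {X P v} w → (∀ {u} → u ∈ X → u ∈ P → v ∼ u → u ≡ w) → degIn G X v ≤ suc (degIn G (X ─ P) v)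
  degIn-─ {X} {P} {v} w lost = ≤-trans (∣p∣≤1+∣p-x∣ (X ∩ N G v) w) (s≤s (p⊆q⇒∣p∣≤∣q∣ kept))
    where
    kept : (X ∩ N G v) - w ⊆ (X ─ P) ∩ N G v
    kept u∈ with ∈∩N⁻ (p─q⊆p _ ⁅ w ⁆ u∈)
    ... | u∈X , v∼u = ∈∩N⁺ (x∈p∧x∉q⇒x∈p─q u∈X (λ u∈P → x∈p-y⇒x≢y u∈ (lost u∈X u∈P v∼u))) v∼u

  two-neighbours⇒2≤degIn : ∀ {X v a b} → a ∈ X → b ∈ X → v ∼ a → v ∼ b → a ≢ b → 2 ≤ degIn G X v
  two-neighbours⇒2≤degIn a∈X b∈X v∼a v∼b = two-distinct⇒1<∣p∣ (∈∩N⁺ a∈X v∼a) (∈∩N⁺ b∈X v∼b)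

  neighbour-≢ : ∀ {X v} → 2 ≤ degIn G X v → ∀ w → ∃ λ u → u ∈ X × v ∼ u × u ≢ w
  neighbour-≢ 2≤deg w with 1<∣p∣⇒∃≢ 2≤deg w
  ... | u , u∈X∩Nv , u≢w = u , proj₁ (∈∩N⁻ u∈X∩Nv) , proj₂ (∈∩N⁻ u∈X∩Nv) , u≢w

  neighbour-≢≢ : ∀ {X v} → 3 ≤ degIn G X v → ∀ w w′ → ∃ λ u → u ∈ X × v ∼ u × u ≢ w × u ≢ w′
  neighbour-≢≢ 3≤deg w w′ with 2<∣p∣⇒∃≢≢ 3≤deg w w′
  ... | u , u∈X∩Nv , u≢w , u≢w′ = u , proj₁ (∈∩N⁻ u∈X∩Nv) , proj₂ (∈∩N⁻ u∈X∩Nv) , u≢w , u≢w′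

  degIn≤2⇒neighbour-∈-two : ∀ {X v a b u} → degIn G X v ≤ 2 → a ∈ X → b ∈ X → v ∼ a → v ∼ b → a ≢ b →
                            u ∈ X → v ∼ u → u ≡ a ⊎ u ≡ b
  degIn≤2⇒neighbour-∈-two deg≤2 a∈X b∈X v∼a v∼b a≢b u∈X v∼u =
    ∣p∣≤2⇒∈-two deg≤2 (∈∩N⁺ a∈X v∼a) (∈∩N⁺ b∈X v∼b) a≢b (∈∩N⁺ u∈X v∼u)

  walk-mono : ∀ {S S′ u v} → S ⊆ S′ → WalkIn G S u v → WalkIn G S′ u v
  walk-mono S⊆S′ (here v∈S)         = here (S⊆S′ v∈S)
  walk-mono S⊆S′ (step u∈S u∼w w⇝v) = step (S⊆S′ u∈S) u∼w (walk-mono S⊆S′ w⇝v)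

  _++ʷ_ : ∀ {S u w v} → WalkIn G S u w → WalkIn G S w v → WalkIn G S u v
  here _           ++ʷ w⇝v = w⇝v
  step u∈S u∼x x⇝w ++ʷ w⇝v = step u∈S u∼x (x⇝w ++ʷ w⇝v)

  ⁅⁆-connected : ∀ x → Connected G ⁅ x ⁆
  ⁅⁆-connected x u v u∈⁅x⁆ v∈⁅x⁆ with x∈⁅y⁆⇒x≡y x u∈⁅x⁆ | x∈⁅y⁆⇒x≡y x v∈⁅x⁆
  ... | refl | refl = here u∈⁅x⁆

  ∪⁅⁆-connected : ∀ {K t x} → Connected G K → t ∈ K → x ∼ t → Connected G (K ∪ ⁅ x ⁆)
  ∪⁅⁆-connected {K} {t} {x} K-connected t∈K x∼t u v u∈ v∈ =
    connect (x∈p∪q⁻ K ⁅ x ⁆ u∈) (x∈p∪q⁻ K ⁅ x ⁆ v∈)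
    where
    x∈ : x ∈ K ∪ ⁅ x ⁆
    x∈ = q⊆p∪q K ⁅ x ⁆ (x∈⁅x⁆ x)
    inK : ∀ {a b} → WalkIn G K a b → WalkIn G (K ∪ ⁅ x ⁆) a b
    inK = walk-mono (p⊆p∪q ⁅ x ⁆)
    connect : ∀ {a b} → a ∈ K ⊎ a ∈ ⁅ x ⁆ → b ∈ K ⊎ b ∈ ⁅ x ⁆ → WalkIn G (K ∪ ⁅ x ⁆) a b
    connect (inj₁ a∈K) (inj₁ b∈K) = inK (K-connected _ _ a∈K b∈K)
    connect (inj₁ a∈K) (inj₂ b∈⁅x⁆) rewrite x∈⁅y⁆⇒x≡y x b∈⁅x⁆ =
      inK (K-connected _ t a∈K t∈K) ++ʷ step (p⊆p∪q ⁅ x ⁆ t∈K) (∼-sym x∼t) (here x∈)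
    connect (inj₂ a∈⁅x⁆) (inj₁ b∈K) rewrite x∈⁅y⁆⇒x≡y x a∈⁅x⁆ = step x∈ x∼t (inK (K-connected t _ t∈K b∈K))
    connect (inj₂ a∈⁅x⁆) (inj₂ b∈⁅x⁆) rewrite x∈⁅y⁆⇒x≡y x a∈⁅x⁆ | x∈⁅y⁆⇒x≡y x b∈⁅x⁆ = here x∈

  singletonModel : Fin n → DominatingModel G 1
  singletonModel x = record
    { branch     = λ _ → ⁅ x ⁆
    ; nonempty   = λ _ → x , x∈⁅x⁆ x
    ; connected  = λ _ → ⁅⁆-connected x
    ; disjoint   = λ { zero zero 0≢0 → ⊥-elim (0≢0 refl) }
    ; dominating = λ { zero zero () }
    }

  prependBranch : ∀ {t} (M : DominatingModel G t) {K Z : Subset n} → Nonempty K → Connected G K →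
                  (∀ i → DominatingModel.branch M i ⊆ Z) → Disjoint G K Z → (∀ {v} → v ∈ Z → DominatedBy K v) →
                  DominatingModel G (suc t)
  prependBranch {t} M {K} {Z} K-nonempty K-connected M⊆Z K∩Z≡∅ K-dominates-Z = record
    { branch     = branch
    ; nonempty   = nonempty
    ; connected  = connected
    ; disjoint   = disjoint
    ; dominating = dominating
    }
    where
    module M = DominatingModel M

    branch : Fin (suc t) → Subset n
    branch zero    = K
    branch (suc i) = M.branch i

    nonempty : ∀ i → Nonempty (branch i)
    nonempty zero    = K-nonempty
    nonempty (suc i) = M.nonempty i

    connected : ∀ i → Connected G (branch i)
    connected zero    = K-connected
    connected (suc i) = M.connected i

    disjoint : ∀ i j → i ≢ j → Disjoint G (branch i) (branch j)
    disjoint zero    zero    i≢j = ⊥-elim (i≢j refl)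
    disjoint zero    (suc j) _   v v∈K v∈Mj = K∩Z≡∅ v v∈K (M⊆Z j v∈Mj)
    disjoint (suc i) zero    _   v v∈Mi v∈K = K∩Z≡∅ v v∈K (M⊆Z i v∈Mi)
    disjoint (suc i) (suc j) i≢j = M.disjoint i j (i≢j ∘ cong suc)

    dominating : ∀ i j → i Data.Fin.< j → ∀ v → v ∈ branch j → DominatedBy (branch i) v
    dominating _       zero    ()
    dominating zero    (suc j) _   v v∈Mj = K-dominates-Z (M⊆Z j v∈Mj)
    dominating (suc i) (suc j) i<j = M.dominating i j (s≤s⁻¹ i<j)

  record PendantEdge (Z A : Subset n) : Set where
    field
      p h         : Fin n
      p∈Z         : p ∈ Z
      h∈Z         : h ∈ Z
      p∉A         : p ∉ A
      h∉A         : h ∉ A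
      p-dominated : DominatedBy A p
      h∼p         : h ∼ p

  ModelIn : Subset n → ℕ → Set
  ModelIn Z t = Σ (DominatingModel G t) λ M → ∀ i → DominatingModel.branch M i ⊆ Z

  edgeModel : ∀ {p h} → h ∼ p → ModelIn (⁅ p ⁆ ∪ ⁅ h ⁆) 2
  edgeModel {p} {h} h∼p = M , λ { zero → p⊆p∪q ⁅ h ⁆ ; (suc zero) → q⊆p∪q ⁅ p ⁆ ⁅ h ⁆ }
    where
    M : DominatingModel G 2
    M = prependBranch (singletonModel h) (p , x∈⁅x⁆ p) (⁅⁆-connected p) (λ _ → id)
          (λ v v∈⁅p⁆ v∈⁅h⁆ → ∼⇒≢ h∼p (trans (sym (x∈⁅y⁆⇒x≡y h v∈⁅h⁆)) (x∈⁅y⁆⇒x≡y p v∈⁅p⁆)))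
          (λ v∈⁅h⁆ → p , x∈⁅x⁆ p , subst (_∼ p) (sym (x∈⁅y⁆⇒x≡y h v∈⁅h⁆)) h∼p)

  triangleModel : ∀ {Z A} → Nonempty A → Connected G A → A ⊆ Z →
                  (E : PendantEdge Z A) → DominatedBy A (PendantEdge.h E) → ModelIn Z 3
  triangleModel {Z} {A} A-nonempty A-connected A⊆Z E h-dominated = M , M⊆Z
    where
    open PendantEdge E
    edge : DominatingModel G 2
    edge = proj₁ (edgeModel h∼p)
    edge⊆ph : ∀ i → DominatingModel.branch edge i ⊆ ⁅ p ⁆ ∪ ⁅ h ⁆
    edge⊆ph = proj₂ (edgeModel h∼p)
    A∩ph≡∅ : Disjoint G A (⁅ p ⁆ ∪ ⁅ h ⁆)
    A∩ph≡∅ v v∈A v∈ = [ (λ v≡p → p∉A (subst (_∈ A) v≡p v∈A)) , (λ v≡h → h∉A (subst (_∈ A) v≡h v∈A)) ]′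
                        (∈⁅x⁆∪⁅y⁆⁻ v∈)
    A-dominates-ph : ∀ {v} → v ∈ ⁅ p ⁆ ∪ ⁅ h ⁆ → DominatedBy A v
    A-dominates-ph v∈ = [ (λ v≡p → subst (DominatedBy A) (sym v≡p) p-dominated)
                        , (λ v≡h → subst (DominatedBy A) (sym v≡h) h-dominated) ]′ (∈⁅x⁆∪⁅y⁆⁻ v∈)
    M : DominatingModel G 3
    M = prependBranch edge A-nonempty A-connected edge⊆ph A∩ph≡∅ A-dominates-ph
    M⊆Z : ∀ i → DominatingModel.branch M i ⊆ Z
    M⊆Z zero    = A⊆Z
    M⊆Z (suc i) v∈ = [ (λ v≡p → subst (_∈ Z) (sym v≡p) p∈Z) , (λ v≡h → subst (_∈ Z) (sym v≡h) h∈Z) ]′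
                       (∈⁅x⁆∪⁅y⁆⁻ (edge⊆ph i v∈))

  module _ {Z : Subset n} (Z-minDegree : MinDegree Z 2) where

    extendPendantEdge : ∀ A → Acc _⊃_ A → Nonempty A → Connected G A → A ⊆ Z → PendantEdge Z A → ModelIn Z 3
    extendPendantEdge A (acc rs) A-nonempty A-connected A⊆Z E
      with neighbour-≢ (Z-minDegree (PendantEdge.h∈Z E)) (PendantEdge.p E)
    ... | x , x∈Z , h∼x , x≢p with x ∈? A
    ...   | yes x∈A = triangleModel A-nonempty A-connected A⊆Z E (x , x∈A , h∼x)
    ...   | no  x∉A = extendPendantEdge (A ∪ ⁅ p ⁆) (rs (p⊂p∪⁅x⁆ p∉A))
                        (proj₁ A-nonempty , p⊆p∪q ⁅ p ⁆ (proj₂ A-nonempty))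
                        (∪⁅⁆-connected A-connected (proj₁ (proj₂ p-dominated)) (proj₂ (proj₂ p-dominated)))
                        (λ v∈ → [ A⊆Z , ⁅x⁆⊆p p∈Z ]′ (x∈p∪q⁻ A ⁅ p ⁆ v∈))
                        E′
      where
      open PendantEdge E
      E′ : PendantEdge Z (A ∪ ⁅ p ⁆)
      E′ = record
        { p           = h
        ; h           = x
        ; p∈Z         = h∈Z
        ; h∈Z         = x∈Z
        ; p∉A         = λ h∈ → [ h∉A , (λ h∈⁅p⁆ → ∼⇒≢ h∼p (x∈⁅y⁆⇒x≡y p h∈⁅p⁆)) ]′ (x∈p∪q⁻ A ⁅ p ⁆ h∈)
        ; h∉A         = λ x∈ → [ x∉A , (λ x∈⁅p⁆ → x≢p (x∈⁅y⁆⇒x≡y p x∈⁅p⁆)) ]′ (x∈p∪q⁻ A ⁅ p ⁆ x∈)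
        ; p-dominated = p , q⊆p∪q A ⁅ p ⁆ (x∈⁅x⁆ p) , h∼p
        ; h∼p         = ∼-sym h∼x
        }

    minDegree2⇒dominatingK3 : ∀ {z} → z ∈ Z → ModelIn Z 3
    minDegree2⇒dominatingK3 {z} z∈Z with neighbour-≢ (Z-minDegree z∈Z) z
    ... | a , a∈Z , z∼a , _ with neighbour-≢ (Z-minDegree a∈Z) z
    ...   | c , c∈Z , a∼c , c≢z =
      extendPendantEdge ⁅ z ⁆ (⊃-wellFounded ⁅ z ⁆) (z , x∈⁅x⁆ z) (⁅⁆-connected z) (⁅x⁆⊆p z∈Z) record
        { p           = a
        ; h           = c
        ; p∈Z         = a∈Z
        ; h∈Z         = c∈Z
        ; p∉A         = λ a∈⁅z⁆ → ∼⇒≢ z∼a (sym (x∈⁅y⁆⇒x≡y z a∈⁅z⁆))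
        ; h∉A         = λ c∈⁅z⁆ → c≢z (x∈⁅y⁆⇒x≡y z c∈⁅z⁆)
        ; p-dominated = z , x∈⁅x⁆ z , ∼-sym z∼a
        ; h∼p         = ∼-sym a∼c
        }

  record Closure (K B : Subset n) : Set where
    field
      hull           : Subset n
      K⊆hull         : K ⊆ hull
      hull⊆K∪B       : hull ⊆ K ∪ B
      hull-connected : Connected G hull
      hull-closed    : ∀ {b} → b ∈ B → b ∉ hull → ¬ DominatedBy hull b

  closure : ∀ {B} K → Acc _⊃_ K → Connected G K → Closure K B
  closure {B} K (acc rs) K-connected with any? (λ b → b ∈? B ×-dec ¬? (b ∈? K) ×-dec dominatedBy? K b)
  ... | no none = record
    { hull           = K
    ; K⊆hull         = λ v∈K → v∈K
    ; hull⊆K∪B       = p⊆p∪q B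
    ; hull-connected = K-connected
    ; hull-closed    = λ b∈B b∉K b-dominated → none (_ , b∈B , b∉K , b-dominated)
    }
  ... | yes (b , b∈B , b∉K , u , u∈K , b∼u) = record
    { hull           = hull
    ; K⊆hull         = K⊆hull ∘ p⊆p∪q ⁅ b ⁆
    ; hull⊆K∪B       = λ v∈hull → [ [ p⊆p∪q B , (λ v∈⁅b⁆ → q⊆p∪q K B (⁅x⁆⊆p b∈B v∈⁅b⁆)) ]′ ∘ x∈p∪q⁻ K ⁅ b ⁆
                                  , q⊆p∪q K B ]′ (x∈p∪q⁻ (K ∪ ⁅ b ⁆) B (hull⊆K∪B v∈hull))
    ; hull-connected = hull-connected
    ; hull-closed    = hull-closed
    }
    where open Closure (closure (K ∪ ⁅ b ⁆) (rs (p⊂p∪⁅x⁆ b∉K)) (∪⁅⁆-connected K-connected u∈K b∼u))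

  2≤degIn-─ : ∀ X P {v} → 2 ≤ degIn G X v → (∀ {u} → u ∈ X → u ∈ P → ¬ v ∼ u) → 2 ≤ degIn G (X ─ P) v
  2≤degIn-─ X P 2≤deg untouched =
    ≤-trans 2≤deg (degIn-mono λ u∈X v∼u → x∈p∧x∉q⇒x∈p─q u∈X λ u∈P → untouched u∈X u∈P v∼u)

  3≤degIn⇒2≤degIn-─ : ∀ X P {v} w → 3 ≤ degIn G X v → (∀ {u} → u ∈ X → u ∈ P → v ∼ u → u ≡ w) →
                      2 ≤ degIn G (X ─ P) v
  3≤degIn⇒2≤degIn-─ X P w 3≤deg lost = s≤s⁻¹ (≤-trans 3≤deg (degIn-─ w lost))

  -- K is the future first branch set of the model.
  Admissible : Subset n → Subset n → Set
  Admissible K X = ∀ {v} → v ∈ X → 3 ≤ degIn G X v ⊎ (DominatedBy K v × 2 ≤ degIn G X v)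

  record Core (X : Subset n) : Set where
    field
      core           : Subset n
      core⊆X         : core ⊆ X
      core-nonempty  : Nonempty core
      core-minDegree : MinDegree core 2

  data CoreCase (K X : Subset n) : Set where
    dominated-core : (C : Core X) → (∀ {v} → v ∈ Core.core C → DominatedBy K v) → CoreCase K X
    core-missing   : (C : Core X) → ∀ {y} → y ∈ X → DominatedBy K y → y ∉ Core.core C → CoreCase K X

  module _ {K X : Subset n} (admissible : Admissible K X) where

    Tight : Fin n → Set
    Tight v = v ∈ X × degIn G X v ≤ 2

    tight? : ∀ v → Dec (Tight v)
    tight? v = v ∈? X ×-dec degIn G X v ≤? 2

    2≤degIn : ∀ {v} → v ∈ X → 2 ≤ degIn G X v
    2≤degIn v∈X = [ ≤-trans (n≤1+n 2) , proj₂ ]′ (admissible v∈X)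

    tight⇒dominated : ∀ {v} → Tight v → DominatedBy K v
    tight⇒dominated (v∈X , deg≤2) = [ (λ 3≤deg → ⊥-elim (≤⇒≯ deg≤2 3≤deg)) , proj₁ ]′ (admissible v∈X)

    loose⇒3≤degIn : ∀ {v} → v ∈ X → ¬ Tight v → 3 ≤ degIn G X v
    loose⇒3≤degIn v∈X ¬tight = ≰⇒> λ deg≤2 → ¬tight (v∈X , deg≤2)

    undominated⇒3≤degIn : ∀ {v} → v ∈ X → ¬ DominatedBy K v → 3 ≤ degIn G X v
    undominated⇒3≤degIn v∈X ¬dominated =
      [ id , (λ (dominated , _) → ⊥-elim (¬dominated dominated)) ]′ (admissible v∈X)

    -- A walk s, t, …, q, h whose vertices P after s are tight; q is the predecessor of the
    -- head h, and only h may have a neighbour in X beyond its walk neighbours.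
    record TightWalk (s t : Fin n) (P : Subset n) : Set where
      field
        h q     : Fin n
        P⊆tight : ∀ {p} → p ∈ P → Tight p
        t∈P     : t ∈ P
        h∈P     : h ∈ P
        h∼q     : h ∼ q
        back    : (q ∈ P × h ≢ t) ⊎ (q ≡ s × h ≡ t)
        head    : ∀ {p} → p ∈ P → h ∼ p → p ≡ q
        closed  : ∀ {p u} → p ∈ P → p ≢ h → u ∈ X → p ∼ u → u ∈ P ⊎ (p ≡ t × u ≡ s)

    -- A maximal path P of tight vertices from t to h: its only edges to the rest of X are
    -- t et and h eh, where et and eh are loose (possibly equal).
    record TightPath : Set where
      field
        P            : Subset n
        t h et eh    : Fin n
        P⊆tight      : ∀ {p} → p ∈ P → Tight p
        t∈P          : t ∈ P
        h∈P          : h ∈ P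
        et∈X         : et ∈ X
        eh∈X         : eh ∈ X
        et-loose     : ¬ Tight et
        eh-loose     : ¬ Tight eh
        t∼et         : t ∼ et
        h∼eh         : h ∼ eh
        closed       : ∀ {p u} → p ∈ P → u ∈ X → p ∼ u → u ∈ P ⊎ (p ≡ t × u ≡ et) ⊎ (p ≡ h × u ≡ eh)
        et≡eh⇒t≢h    : et ≡ eh → t ≢ h

    module _ {s t : Fin n} (s∈X : s ∈ X) (s-loose : ¬ Tight s) (t∼s : t ∼ s) where

      module Step {P : Subset n} (W : TightWalk s t P) {x : Fin n}
                  (x∈X : x ∈ X) (h∼x : TightWalk.h W ∼ x) (x≢q : x ≢ TightWalk.q W) where
        open TightWalk W

        q∈X : q ∈ X
        q∈X = [ (λ (q∈P , _) → proj₁ (P⊆tight q∈P)) , (λ (q≡s , _) → subst (_∈ X) (sym q≡s) s∈X) ]′ back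

        h-neighbour : ∀ {u} → u ∈ X → h ∼ u → u ≡ q ⊎ u ≡ x
        h-neighbour = degIn≤2⇒neighbour-∈-two (proj₂ (P⊆tight h∈P)) q∈X x∈X h∼q h∼x (x≢q ∘ sym)

        behind-h : ∀ {u} → u ≡ q → u ∈ P ⊎ (h ≡ t × u ≡ s)
        behind-h u≡q = [ (λ (q∈P , _) → inj₁ (subst (_∈ P) (sym u≡q) q∈P))
                       , (λ (q≡s , h≡t) → inj₂ (h≡t , trans u≡q q≡s)) ]′ back

        finish : ¬ Tight x → TightPath
        finish x-loose = record
          { P         = P
          ; t         = t
          ; h         = h
          ; et        = s
          ; eh        = x
          ; P⊆tight   = P⊆tight
          ; t∈P       = t∈P
          ; h∈P       = h∈P
          ; et∈X      = s∈X
          ; eh∈X      = x∈X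
          ; et-loose  = s-loose
          ; eh-loose  = x-loose
          ; t∼et      = t∼s
          ; h∼eh      = h∼x
          ; closed    = closed′
          ; et≡eh⇒t≢h = λ s≡x t≡h → [ (λ (_ , h≢t) → h≢t (sym t≡h))
                                     , (λ (q≡s , _) → x≢q (trans (sym s≡x) (sym q≡s))) ]′ back
          }
          where
          closed′ : ∀ {p u} → p ∈ P → u ∈ X → p ∼ u → u ∈ P ⊎ (p ≡ t × u ≡ s) ⊎ (p ≡ h × u ≡ x)
          closed′ {p} p∈P u∈X p∼u with p ≟ h
          ... | no  p≢h = ⊎-map₂ inj₁ (closed p∈P p≢h u∈X p∼u)
          ... | yes refl with h-neighbour u∈X p∼u
          ...   | inj₁ u≡q = ⊎-map₂ inj₁ (behind-h u≡q)
          ...   | inj₂ u≡x = inj₂ (inj₂ (refl , u≡x))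

        extend : x ∉ P → Tight x → TightWalk s t (P ∪ ⁅ x ⁆)
        extend x∉P x-tight = record
          { h       = x
          ; q       = h
          ; P⊆tight = λ v∈ → [ P⊆tight , (λ v∈⁅x⁆ → subst Tight (sym (x∈⁅y⁆⇒x≡y x v∈⁅x⁆)) x-tight) ]′
                               (x∈p∪q⁻ P ⁅ x ⁆ v∈)
          ; t∈P     = inP t∈P
          ; h∈P     = x∈P∪⁅x⁆
          ; h∼q     = ∼-sym h∼x
          ; back    = inj₁ (inP h∈P , λ x≡t → x∉P (subst (_∈ P) (sym x≡t) t∈P))
          ; head    = head′
          ; closed  = closed′
          }
          where
          inP : P ⊆ P ∪ ⁅ x ⁆
          inP = p⊆p∪q ⁅ x ⁆
          x∈P∪⁅x⁆ : x ∈ P ∪ ⁅ x ⁆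
          x∈P∪⁅x⁆ = q⊆p∪q P ⁅ x ⁆ (x∈⁅x⁆ x)
          head′ : ∀ {p} → p ∈ P ∪ ⁅ x ⁆ → x ∼ p → p ≡ h
          head′ {p} p∈ x∼p with x∈p∪q⁻ P ⁅ x ⁆ p∈
          ... | inj₂ p∈⁅x⁆ = ⊥-elim (∼⇒≢ x∼p (sym (x∈⁅y⁆⇒x≡y x p∈⁅x⁆)))
          ... | inj₁ p∈P with p ≟ h
          ...   | yes p≡h = p≡h
          ...   | no  p≢h = ⊥-elim ([ x∉P , (λ (_ , x≡s) → s-loose (subst Tight x≡s x-tight)) ]′
                                      (closed p∈P p≢h x∈X (∼-sym x∼p)))
          closed′ : ∀ {p u} → p ∈ P ∪ ⁅ x ⁆ → p ≢ x → u ∈ X → p ∼ u → u ∈ P ∪ ⁅ x ⁆ ⊎ (p ≡ t × u ≡ s)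
          closed′ {p} p∈ p≢x u∈X p∼u with x∈p∪q⁻ P ⁅ x ⁆ p∈
          ... | inj₂ p∈⁅x⁆ = ⊥-elim (p≢x (x∈⁅y⁆⇒x≡y x p∈⁅x⁆))
          ... | inj₁ p∈P with p ≟ h
          ...   | no  p≢h = ⊎-map₁ inP (closed p∈P p≢h u∈X p∼u)
          ...   | yes refl with h-neighbour u∈X p∼u
          ...     | inj₁ u≡q = ⊎-map₁ inP (behind-h u≡q)
          ...     | inj₂ u≡x = inj₁ (subst (_∈ P ∪ ⁅ x ⁆) (sym u≡x) x∈P∪⁅x⁆)

      followTightWalk : ∀ P → Acc _⊃_ P → TightWalk s t P → TightPath
      followTightWalk P (acc rs) W
        with neighbour-≢ (2≤degIn (proj₁ (TightWalk.P⊆tight W (TightWalk.h∈P W)))) (TightWalk.q W)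
      ... | x , x∈X , h∼x , x≢q with x ∈? P | tight? x
      ...   | yes x∈P | _          = ⊥-elim (x≢q (TightWalk.head W x∈P h∼x))
      ...   | no  x∉P | no  x-loose = Step.finish W x∈X h∼x x≢q x-loose
      ...   | no  x∉P | yes x-tight =
        followTightWalk (P ∪ ⁅ x ⁆) (rs (p⊂p∪⁅x⁆ x∉P)) (Step.extend W x∈X h∼x x≢q x∉P x-tight)

      tightPathFrom : Tight t → TightPath
      tightPathFrom t-tight = followTightWalk ⁅ t ⁆ (⊃-wellFounded ⁅ t ⁆) record
        { h       = t
        ; q       = s
        ; P⊆tight = λ p∈⁅t⁆ → subst Tight (sym (x∈⁅y⁆⇒x≡y t p∈⁅t⁆)) t-tight
        ; t∈P     = x∈⁅x⁆ t
        ; h∈P     = x∈⁅x⁆ t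
        ; h∼q     = t∼s
        ; back    = inj₂ (refl , refl)
        ; head    = λ p∈⁅t⁆ t∼p → ⊥-elim (∼⇒≢ t∼p (sym (x∈⁅y⁆⇒x≡y t p∈⁅t⁆)))
        ; closed  = λ p∈⁅t⁆ p≢t → ⊥-elim (p≢t (x∈⁅y⁆⇒x≡y t p∈⁅t⁆))
        }

    module OpenTightPath (T : TightPath) (et≢eh : TightPath.et T ≢ TightPath.eh T) where
      open TightPath T

      P-neighbour : ∀ {v u} → v ∈ X ─ P → u ∈ P → v ∼ u → (u ≡ t × v ≡ et) ⊎ (u ≡ h × v ≡ eh)
      P-neighbour v∈ u∈P v∼u =
        [ (λ v∈P → ⊥-elim (x∈p─q⇒x∉q v∈ v∈P)) , id ]′ (closed u∈P (p─q⊆p X P v∈) (∼-sym v∼u))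

      minDegree : MinDegree (X ─ P) 2
      minDegree {v} v∈ with v ≟ et | v ≟ eh
      ... | yes refl | _ = 3≤degIn⇒2≤degIn-─ X P t (loose⇒3≤degIn et∈X et-loose) λ _ u∈P v∼u →
        [ proj₁ , (λ (_ , v≡eh) → ⊥-elim (et≢eh v≡eh)) ]′ (P-neighbour v∈ u∈P v∼u)
      ... | no _ | yes refl = 3≤degIn⇒2≤degIn-─ X P h (loose⇒3≤degIn eh∈X eh-loose) λ _ u∈P v∼u →
        [ (λ (_ , v≡et) → ⊥-elim (et≢eh (sym v≡et))) , proj₁ ]′ (P-neighbour v∈ u∈P v∼u)
      ... | no v≢et | no v≢eh = 2≤degIn-─ X P (2≤degIn (p─q⊆p X P v∈)) λ _ u∈P v∼u →
        [ v≢et ∘ proj₂ , v≢eh ∘ proj₂ ]′ (P-neighbour v∈ u∈P v∼u)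

      coreCase : CoreCase K X
      coreCase = core-missing
        record
          { core           = X ─ P
          ; core⊆X         = p─q⊆p X P
          ; core-nonempty  = et , x∈p∧x∉q⇒x∈p─q et∈X (et-loose ∘ P⊆tight)
          ; core-minDegree = minDegree
          }
        (proj₁ (P⊆tight t∈P)) (tight⇒dominated (P⊆tight t∈P)) (λ t∈ → x∈p─q⇒x∉q t∈ t∈P)

    -- Q = P + et is a cycle. If K dominates neither et nor any vertex off Q, then removing Q
    -- costs each remaining vertex, of X-degree ≥ 3, at most the neighbour et.
    module ClosedTightPath (T : TightPath) (et≡eh : TightPath.et T ≡ TightPath.eh T) where
      open TightPath T

      Q : Subset n
      Q = P ∪ ⁅ et ⁆

      P⊆Q : P ⊆ Q
      P⊆Q = p⊆p∪q ⁅ et ⁆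

      et∈Q : et ∈ Q
      et∈Q = q⊆p∪q P ⁅ et ⁆ (x∈⁅x⁆ et)

      Q-neighbour : ∀ {p u} → p ∈ P → u ∈ X → p ∼ u → u ∈ Q
      Q-neighbour p∈P u∈X p∼u with closed p∈P u∈X p∼u
      ... | inj₁ u∈P              = P⊆Q u∈P
      ... | inj₂ (inj₁ (_ , refl)) = et∈Q
      ... | inj₂ (inj₂ (_ , u≡eh)) = subst (_∈ Q) (trans et≡eh (sym u≡eh)) et∈Q

      cycle : Core X
      cycle = record
        { core           = Q
        ; core⊆X         = λ v∈Q → [ proj₁ ∘ P⊆tight , (λ v∈⁅et⁆ → ⁅x⁆⊆p et∈X v∈⁅et⁆) ]′ (x∈p∪q⁻ P ⁅ et ⁆ v∈Q)
        ; core-nonempty  = t , P⊆Q t∈P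
        ; core-minDegree = λ v∈Q → [ minDegree-P , minDegree-et ]′ (x∈p∪q⁻ P ⁅ et ⁆ v∈Q)
        }
        where
        minDegree-P : ∀ {v} → v ∈ P → 2 ≤ degIn G Q v
        minDegree-P v∈P = ≤-trans (2≤degIn (proj₁ (P⊆tight v∈P))) (degIn-mono (Q-neighbour v∈P))
        minDegree-et : ∀ {v} → v ∈ ⁅ et ⁆ → 2 ≤ degIn G Q v
        minDegree-et v∈⁅et⁆ rewrite x∈⁅y⁆⇒x≡y et v∈⁅et⁆ =
          two-neighbours⇒2≤degIn (P⊆Q t∈P) (P⊆Q h∈P) (∼-sym t∼et)
            (∼-sym (subst (h ∼_) (sym et≡eh) h∼eh)) (et≡eh⇒t≢h et≡eh)

      t-missing : t ∉ X ─ Q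
      t-missing t∈ = x∈p─q⇒x∉q t∈ (P⊆Q t∈P)

      coreCase : CoreCase K X
      coreCase with dominatedBy? K et
      ... | yes et-dominated = dominated-core cycle λ v∈Q →
        [ tight⇒dominated ∘ P⊆tight
        , (λ v∈⁅et⁆ → subst (DominatedBy K) (sym (x∈⁅y⁆⇒x≡y et v∈⁅et⁆)) et-dominated) ]′ (x∈p∪q⁻ P ⁅ et ⁆ v∈Q)
      ... | no et-undominated with any? (λ y → y ∈? X ×-dec dominatedBy? K y ×-dec ¬? (y ∈? Q))
      ...   | yes (y , y∈X , y-dominated , y∉Q) = core-missing cycle y∈X y-dominated y∉Q
      ...   | no Q-contains-dominated with neighbour-≢≢ (undominated⇒3≤degIn et∈X et-undominated) t h
      ...     | f , f∈X , et∼f , f≢t , f≢h = core-missing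
        record
          { core           = X ─ Q
          ; core⊆X         = p─q⊆p X Q
          ; core-nonempty  = f , x∈p∧x∉q⇒x∈p─q f∈X f∉Q
          ; core-minDegree = minDegree
          }
        (proj₁ (P⊆tight t∈P)) (tight⇒dominated (P⊆tight t∈P)) t-missing
        where
        f∉Q : f ∉ Q
        f∉Q f∈Q with x∈p∪q⁻ P ⁅ et ⁆ f∈Q
        ... | inj₂ f∈⁅et⁆ = ∼⇒≢ et∼f (sym (x∈⁅y⁆⇒x≡y et f∈⁅et⁆))
        ... | inj₁ f∈P with closed f∈P et∈X (∼-sym et∼f)
        ...   | inj₁ et∈P              = et-loose (P⊆tight et∈P)
        ...   | inj₂ (inj₁ (f≡t , _)) = f≢t f≡t
        ...   | inj₂ (inj₂ (f≡h , _)) = f≢h f≡h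
        Q-neighbour⇒et : ∀ {v u} → v ∈ X ─ Q → u ∈ X → u ∈ Q → v ∼ u → u ≡ et
        Q-neighbour⇒et {v} v∈ u∈X u∈Q v∼u with x∈p∪q⁻ P ⁅ et ⁆ u∈Q
        ... | inj₂ u∈⁅et⁆ = x∈⁅y⁆⇒x≡y et u∈⁅et⁆
        ... | inj₁ u∈P = ⊥-elim (x∈p─q⇒x∉q v∈ (Q-neighbour u∈P (p─q⊆p X Q v∈) (∼-sym v∼u)))
        minDegree : MinDegree (X ─ Q) 2
        minDegree {v} v∈ = 3≤degIn⇒2≤degIn-─ X Q et
          (undominated⇒3≤degIn v∈X λ v-dominated → Q-contains-dominated (v , v∈X , v-dominated , x∈p─q⇒x∉q v∈))
          (Q-neighbour⇒et v∈)
          where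
          v∈X : v ∈ X
          v∈X = p─q⊆p X Q v∈

    tightPath⇒coreCase : TightPath → CoreCase K X
    tightPath⇒coreCase T with TightPath.et T ≟ TightPath.eh T
    ... | yes et≡eh = ClosedTightPath.coreCase T et≡eh
    ... | no  et≢eh = OpenTightPath.coreCase T et≢eh

    -- Without a loose vertex next to a tight one, the tight vertices form disjoint cycles;
    -- without tight vertices, X − y has minimum degree 2.
    findCore : ∀ {y} → y ∈ X → DominatedBy K y → CoreCase K X
    findCore {y} y∈X y-dominated
      with any? (λ s → s ∈? X ×-dec ¬? (tight? s) ×-dec any? (λ t → tight? t ×-dec t ∼? s))
    ... | yes (s , s∈X , s-loose , t , t-tight , t∼s) = tightPath⇒coreCase (tightPathFrom s∈X s-loose t∼s t-tight)
    ... | no tight-closed with any? tight?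
    ...   | yes (t , t-tight) = dominated-core tightCore (tight⇒dominated ∘ toWitness ∘ x∈tabulate⁻)
      where
      tightCore : Core X
      tightCore = record
        { core           = tabulate (λ v → ⌊ tight? v ⌋)
        ; core⊆X         = proj₁ ∘ toWitness ∘ x∈tabulate⁻
        ; core-nonempty  = t , x∈tabulate⁺ (fromWitness t-tight)
        ; core-minDegree = λ v∈ → let v-tight = toWitness (x∈tabulate⁻ v∈) in
            ≤-trans (2≤degIn (proj₁ v-tight)) (degIn-mono λ {u} u∈X v∼u → x∈tabulate⁺ (fromWitness
              (decidable-stable (tight? u) λ u-loose → tight-closed (u , u∈X , u-loose , _ , v-tight , v∼u))))
        }
    ...   | no no-tight with neighbour-≢ (2≤degIn y∈X) y
    ...     | u , u∈X , _ , u≢y = core-missing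
      record
        { core           = X - y
        ; core⊆X         = p─q⊆p X ⁅ y ⁆
        ; core-nonempty  = u , x∈p∧x≢y⇒x∈p-y u∈X u≢y
        ; core-minDegree = λ {v} v∈ → 3≤degIn⇒2≤degIn-─ X ⁅ y ⁆ y
            (loose⇒3≤degIn (p─q⊆p X ⁅ y ⁆ v∈) (no-tight ∘ (v ,_))) (λ _ u∈⁅y⁆ _ → x∈⁅y⁆⇒x≡y y u∈⁅y⁆)
        }
      y∈X y-dominated (λ y∈ → x∈p-y⇒x≢y y∈ refl)

  record Configuration (X : Subset n) : Set where
    field
      K           : Subset n
      K-nonempty  : Nonempty K
      K-connected : Connected G K
      K∩X≡∅       : Disjoint G K X
      admissible  : Admissible K X

  minDegree3⇒configuration : ∀ {S x} → x ∈ S → MinDegree S 3 → Configuration (S - x) × Nonempty (S - x)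
  minDegree3⇒configuration {S} {x} x∈S S-minDegree = configuration , nonempty
    where
    nonempty : Nonempty (S - x)
    nonempty with neighbour-≢ (≤-trans (n≤1+n 2) (S-minDegree x∈S)) x
    ... | u , u∈S , _ , u≢x = u , x∈p∧x≢y⇒x∈p-y u∈S u≢x
    admissible : Admissible ⁅ x ⁆ (S - x)
    admissible {v} v∈ with v ∼? x
    ... | yes v∼x = inj₂ ((x , x∈⁅x⁆ x , v∼x) , 3≤degIn⇒2≤degIn-─ S ⁅ x ⁆ x (S-minDegree (p─q⊆p S ⁅ x ⁆ v∈))
                                                  λ _ u∈⁅x⁆ _ → x∈⁅y⁆⇒x≡y x u∈⁅x⁆)
    ... | no ¬v∼x = inj₁ (≤-trans (S-minDegree (p─q⊆p S ⁅ x ⁆ v∈)) (degIn-mono {Y = S - x} λ u∈S v∼u →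
                     x∈p∧x≢y⇒x∈p-y u∈S λ u≡x → ¬v∼x (subst (v ∼_) u≡x v∼u)))
    configuration : Configuration (S - x)
    configuration = record
      { K           = ⁅ x ⁆
      ; K-nonempty  = x , x∈⁅x⁆ x
      ; K-connected = ⁅⁆-connected x
      ; K∩X≡∅       = λ v v∈⁅x⁆ v∈ → x∈p-y⇒x≢y v∈ (x∈⁅y⁆⇒x≡y x v∈⁅x⁆)
      ; admissible  = admissible
      }

  -- K absorbs the part of X − core it can reach; this takes y and leaves the core.
  coreMissing⇒smallerConfiguration : ∀ {X} (Γ : Configuration X) (C : Core X) {y} → y ∈ X →
                                     DominatedBy (Configuration.K Γ) y → y ∉ Core.core C →
                                     Σ (Subset n) λ X′ → X′ ⊂ X × Nonempty X′ × Configuration X′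
  coreMissing⇒smallerConfiguration {X} Γ C {y} y∈X y-dominated y∉C =
    X ─ hull , X─hull⊂X , X─hull-nonempty , configuration
    where
    open Configuration Γ
    open Core C
    open Closure (closure {B = X ─ core} K (⊃-wellFounded K) K-connected)

    core∩hull≡∅ : ∀ {v} → v ∈ core → v ∉ hull
    core∩hull≡∅ v∈core v∈hull =
      [ (λ v∈K → K∩X≡∅ _ v∈K (core⊆X v∈core)) , (λ v∈X─core → x∈p─q⇒x∉q v∈X─core v∈core) ]′
        (x∈p∪q⁻ K (X ─ core) (hull⊆K∪B v∈hull))

    core⊆X─hull : core ⊆ X ─ hull
    core⊆X─hull v∈core = x∈p∧x∉q⇒x∈p─q (core⊆X v∈core) (core∩hull≡∅ v∈core)

    dominated⇒∈hull : ∀ {v} → v ∈ X → v ∉ core → DominatedBy hull v → v ∈ hull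
    dominated⇒∈hull {v} v∈X v∉core v-dominated with v ∈? hull
    ... | yes v∈hull = v∈hull
    ... | no  v∉hull = ⊥-elim (hull-closed (x∈p∧x∉q⇒x∈p─q v∈X v∉core) v∉hull v-dominated)

    X─hull⊂X : X ─ hull ⊂ X
    X─hull⊂X = p─q⊆p X hull , y , y∈X , λ y∈ →
      x∈p─q⇒x∉q y∈ (dominated⇒∈hull y∈X y∉C (map₂ (map₁ K⊆hull) y-dominated))

    X─hull-nonempty : Nonempty (X ─ hull)
    X─hull-nonempty = proj₁ core-nonempty , core⊆X─hull (proj₂ core-nonempty)

    admissible′ : Admissible hull (X ─ hull)
    admissible′ {v} v∈ with p─q⊆p X hull v∈ | dominatedBy? hull v
    ... | v∈X | yes v-dominated =
      inj₂ (v-dominated , ≤-trans (core-minDegree v∈core) (degIn-mono λ u∈core _ → core⊆X─hull u∈core))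
      where
      v∈core : v ∈ core
      v∈core = decidable-stable (v ∈? core) λ v∉core → x∈p─q⇒x∉q v∈ (dominated⇒∈hull v∈X v∉core v-dominated)
    ... | v∈X | no v-undominated = inj₁ (≤-trans
      (undominated⇒3≤degIn admissible v∈X (v-undominated ∘ map₂ (map₁ K⊆hull)))
      (degIn-mono {Y = X ─ hull} λ u∈X v∼u → x∈p∧x∉q⇒x∈p─q u∈X λ u∈hull → v-undominated (_ , u∈hull , v∼u)))

    configuration : Configuration (X ─ hull)
    configuration = record
      { K           = hull
      ; K-nonempty  = proj₁ K-nonempty , K⊆hull (proj₂ K-nonempty)
      ; K-connected = hull-connected
      ; K∩X≡∅       = λ v v∈hull v∈ → x∈p─q⇒x∉q v∈ v∈hull
      ; admissible  = admissible′
      }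

  dominatedCore⇒dominatingK4 : ∀ {X} (Γ : Configuration X) (C : Core X) →
                               (∀ {v} → v ∈ Core.core C → DominatedBy (Configuration.K Γ) v) → DominatingModel G 4
  dominatedCore⇒dominatingK4 Γ C C-dominated =
    let M , M⊆C = minDegree2⇒dominatingK3 core-minDegree (proj₂ core-nonempty)
    in prependBranch M K-nonempty K-connected M⊆C (λ v v∈K v∈C → K∩X≡∅ v v∈K (core⊆X v∈C)) C-dominated
    where
    open Configuration Γ
    open Core C

  configuration⇒dominatingK4 : ∀ X → Acc _⊂_ X → Nonempty X → Configuration X → DominatingModel G 4
  configuration⇒dominatingK4 X (acc rs) (x , x∈X) Γ with any? (λ v → v ∈? X ×-dec dominatedBy? (Configuration.K Γ) v)
  ... | no X-undominated =
    let Γ′ , nonempty = minDegree3⇒configuration x∈X λ v∈X →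
          undominated⇒3≤degIn (Configuration.admissible Γ) v∈X λ v-dominated → X-undominated (_ , v∈X , v-dominated)
    in configuration⇒dominatingK4 (X - x) (rs (x∈p⇒p-x⊂p x∈X)) nonempty Γ′
  ... | yes (_ , y∈X , y-dominated) with findCore (Configuration.admissible Γ) y∈X y-dominated
  ...   | dominated-core C C-dominated = dominatedCore⇒dominatingK4 Γ C C-dominated
  ...   | core-missing C y′∈X y′-dominated y′∉C =
    let X′ , X′⊂X , nonempty , Γ′ = coreMissing⇒smallerConfiguration Γ C y′∈X y′-dominated y′∉C
    in configuration⇒dominatingK4 X′ (rs X′⊂X) nonempty Γ′
  minDegree3⇒dominatingK4 : ∀ {S x} → x ∈ S → MinDegree S 3 → DominatingModel G 4
  minDegree3⇒dominatingK4 {S} {x} x∈S S-minDegree =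
    let Γ , nonempty = minDegree3⇒configuration x∈S S-minDegree
    in configuration⇒dominatingK4 (S - x) (⊂-wellFounded _) nonempty Γ

  noDominatingK4⇒2-degenerate : ¬ DominatingModel G 4 → Degenerate G 2
  noDominatingK4⇒2-degenerate ¬model S (x , x∈S) with any? (λ v → v ∈? S ×-dec degIn G S v ≤? 2)
  ... | yes low = low
  ... | no ¬low = ⊥-elim (¬model (minDegree3⇒dominatingK4 x∈S λ v∈S → ≰⇒> λ deg≤2 → ¬low (_ , v∈S , deg≤2)))

  ProperOn : ∀ {k} → Subset n → (Fin n → Fin k) → Set
  ProperOn S c = ∀ {u v} → u ∈ S → v ∈ S → u ∼ v → c u ≢ c v

  freeColour : ∀ {d S v} (c : Fin n → Fin (suc d)) → degIn G S v ≤ d →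
               ∃ λ κ → ∀ {u} → u ∈ S → v ∼ u → c u ≢ κ
  freeColour {d} {S} {v} c deg≤d with any? (λ κ → ¬? (used? κ))
    where
    used? : ∀ κ → Dec (∃ λ u → u ∈ S × v ∼ u × c u ≡ κ)
    used? κ = any? λ u → u ∈? S ×-dec v ∼? u ×-dec c u ≟ κ
  ... | yes (κ , unused) = κ , λ u∈S v∼u cu≡κ → unused (_ , u∈S , v∼u , cu≡κ)
  ... | no all-used = ⊥-elim (≤⇒≯ deg≤d (injective⇒≤∣p∣ holder holder-injective holder∈S∩Nv))
    where
    used : ∀ κ → ∃ λ u → u ∈ S × v ∼ u × c u ≡ κ
    used κ = decidable-stable (any? λ u → u ∈? S ×-dec v ∼? u ×-dec c u ≟ κ) λ unused → all-used (κ , unused)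
    holder : Fin (suc d) → Fin n
    holder κ = proj₁ (used κ)
    holder-injective : Injective _≡_ _≡_ holder
    holder-injective {κ} {κ′} eq = trans (sym (proj₂ (proj₂ (proj₂ (used κ)))))
                                         (trans (cong c eq) (proj₂ (proj₂ (proj₂ (used κ′)))))
    holder∈S∩Nv : ∀ κ → holder κ ∈ S ∩ N G v
    holder∈S∩Nv κ = ∈∩N⁺ (proj₁ (proj₂ (used κ))) (proj₁ (proj₂ (proj₂ (used κ))))

  colourOn : ∀ {d} → Degenerate G d → ∀ S → Acc _⊂_ S → ∃ λ (c : Fin n → Fin (suc d)) → ProperOn S c
  colourOn degenerate S (acc rs) with nonempty? S
  ... | no S-empty = (λ _ → zero) , λ u∈S → ⊥-elim (S-empty (_ , u∈S))
  ... | yes S-nonempty with degenerate S S-nonempty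
  ...   | v , v∈S , deg≤d with colourOn degenerate (S - v) (rs (x∈p⇒p-x⊂p v∈S))
  ...     | c , c-proper with freeColour c deg≤d
  ...       | κ , κ-free = updateAt c v (const κ) , proper
    where
    proper : ProperOn S (updateAt c v (const κ))
    proper {u} {w} u∈S w∈S u∼w with u ≟ v | w ≟ v
    ... | yes refl | yes refl = ⊥-elim (∼-irrefl u∼w)
    ... | yes refl | no w≢v rewrite updateAt-updates u {const κ} c | updateAt-minimal w u {const κ} c w≢v =
      λ κ≡cw → κ-free w∈S u∼w (sym κ≡cw)
    ... | no u≢v | yes refl rewrite updateAt-updates w {const κ} c | updateAt-minimal u w {const κ} c u≢v =
      κ-free u∈S (∼-sym u∼w)
    ... | no u≢v | no w≢v rewrite updateAt-minimal u v {const κ} c u≢v | updateAt-minimal w v {const κ} c w≢v =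
      c-proper (x∈p∧x≢y⇒x∈p-y u∈S u≢v) (x∈p∧x≢y⇒x∈p-y w∈S w≢v) u∼w

  degenerate⇒colourable : ∀ {d} → Degenerate G d → Colourable G (suc d)
  degenerate⇒colourable degenerate =
    let c , proper = colourOn degenerate ⊤ (⊂-wellFounded ⊤) in c , λ u v → proper ∈⊤ ∈⊤

corollary9 : ∀ (n : ℕ) (G : Graph n) → ¬ DominatingModel G 4 →
             Degenerate G 2 × Colourable G 3
corollary9 n G ¬dominatingK4 = 2-degenerate , degenerate⇒colourable G 2-degenerate
  where
  2-degenerate : Degenerate G 2
  2-degenerate = noDominatingK4⇒2-degenerate G ¬dominatingK4
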